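{- Let $n>1$ be an integer. Then: (1) every $2$-$T_0T^\ast$-perfect number has the form $n=p_1^3$; (2) every $3$-$T_0T^\ast$-perfect number has the form $n=p_1^5$; (3) every $4$-$T_0T^\ast$-perfect number has the form $n=p_1^7$; (4) every $5$-$T_0T^\ast$-perfect number has the form $n=p_1^9$; (5) every $6$-$T_0T^\ast$-perfect number has the form $n=p_1^{11}$; (6) every $7$-$T_0T^\ast$-perfect number has the form $n=p_1^{13}$; (7) every $8$-$T_0T^\ast$-perfect number has the form $n=p_1^{15}$; (8) every $9$-$T_0T^\ast$-perfect number has the form $n=p_1^{17}$ or $n=p_1p_2$; (9) every $10$-$T_0T^\ast$-perfect number has the form $n=p_1^{19}$; here $p_1,p_2$ denote distinct primes.
   Context: $T(m)$ denotes the product of all positive divisors of $m$. A divisor $d$ of $m$ is unitary if $\gcd(d,m/d)=1$, and $T^\ast(m)$ denotes the product of all unitary divisors of $m$. For an integer $k\ge 2$, an integer $n>1$ is called $k$-$T_0T^\ast$-perfect if $T(T^\ast(n))=n^k$. -}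

module Defs where

open import Data.Nat using (ℕ; suc; _/_)
open import Data.Nat.Divisibility using (_∣?_)
open import Data.Nat.Coprimality using (coprime?)
open import Data.List using (List; map; filter; upTo)
open import Data.Nat.ListAction using (product)
open import Relation.Nullary.Decidable using (_×-dec_)

divisors : ℕ → List ℕ
divisors m = filter (λ d → d ∣? m) (map suc (upTo m))

unitaryDivisors : ℕ → List ℕ
unitaryDivisors m =
  map suc (filter (λ i → (suc i ∣? m) ×-dec coprime? (suc i) (m / suc i)) (upTo m))

Tdiv : ℕ → ℕ
Tdiv m = product (divisors m)

Tstar : ℕ → ℕ
Tstar m = product (unitaryDivisors m)

-- Pairing each divisor d of m with m / d gives T(m)² = m^τ(m), and pairing unitary
-- divisors the same way gives T*(n)² = n^τ*(n); so T(T*(n)) = n^k forces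
-- τ*(n) · τ(T*(n)) = 4k. For n = p^a this reads 2(a + 1) = 4k, i.e. a = 2k − 1.
-- Otherwise n = p^a q^b s with s coprime to p and q; then τ*(n) ≥ 4 and n² ∣ T*(n), so
-- τ(T*(n)) ≥ (2a + 1)(2b + 1) ≥ 9, and s > 1 even gives τ*(n) ≥ 8. As 4k ≤ 40 only
-- a = b = s = 1 survives, where τ*(n) = 4, T*(n) = n² and τ(n²) = 9 force k = 9.

module Submission where

open import Defs
open import Data.Nat
open import Data.Nat.Properties
open import Algebra.Properties.CommutativeSemigroup *-commutativeSemigroup using (x∙yz≈y∙xz)
open import Data.Nat.Divisibility
open import Data.Nat.DivMod using (m*n/n≡m; m*[n/m]≡n)
open import Data.Nat.Coprimality as Coprime using (Coprime; coprime?; coprime-divisor)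
open import Data.Nat.Primality using (Prime; prime⇒irreducible; prime⇒nonZero; prime⇒nonTrivial)
open import Data.Nat.Primality.Factorisation using (factorise; PrimeFactorisation)
open import Data.Nat.Induction using (<-wellFounded)
open import Data.Nat.ListAction using (product)
open import Data.Nat.ListAction.Properties using (product-↭; product-++)
open import Data.Nat.Tactic.RingSolver using (solve-∀)
open import Data.List using (List; []; _∷_; _++_; map; length; filter; upTo; cartesianProductWith)
open import Data.List.Properties using (length-filter; length-map; length-++; length-upTo; map-∘; map-id-local)
open import Data.List.Relation.Unary.All as All using (All; []; _∷_)
open import Data.List.Relation.Unary.AllPairs using ([]; _∷_)
open import Data.List.Relation.Unary.Any using (here; there)
open import Data.List.Relation.Unary.Unique.Propositional using (Unique)
import Data.List.Relation.Unary.Unique.Propositional.Properties as Unique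
open import Data.List.Membership.Propositional using (_∈_)
open import Data.List.Membership.Propositional.Properties
  using ( ∈-map⁺; ∈-map⁻; ∈-++⁻; ∈-filter⁺; ∈-filter⁻; ∈-upTo⁺; ∈-upTo⁻
        ; ∈-cartesianProductWith⁺; ∈-cartesianProductWith⁻)
open import Data.List.Membership.Propositional.Properties.WithK using (unique∧set⇒bag)
open import Data.List.Membership.DecPropositional _≟_ using (_∈?_)
open import Data.List.Relation.Binary.Subset.Propositional using (_⊆_)
open import Data.List.Relation.Binary.Permutation.Propositional using (_↭_)
open import Data.List.Relation.Binary.Permutation.Propositional.Properties using (↭-length)
open import Data.List.Relation.Binary.BagAndSetEquality using (∼bag⇒↭)
open import Data.Product using (∃-syntax; ∃₂; _×_; _,_; proj₂)
open import Data.Sum as Sum using (_⊎_; inj₁; inj₂)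
open import Function using (_∘_; case_of_; mk⇔)
open import Induction.WellFounded using (Acc; acc)
open import Relation.Binary.Definitions using (tri<; tri≈; tri>)
open import Relation.Binary.PropositionalEquality
open import Relation.Nullary using (¬_; yes; no; contradiction)
open import Relation.Nullary.Decidable using (True; toWitness; _×-dec_)
open import Relation.Unary using (Pred; Decidable)

unique∧⊆∧⊇⇒↭ : {xs ys : List ℕ} → Unique xs → Unique ys → xs ⊆ ys → ys ⊆ xs → xs ↭ ys
unique∧⊆∧⊇⇒↭ xs! ys! xs⊆ys ys⊆xs = ∼bag⇒↭ (unique∧set⇒bag xs! ys! (mk⇔ xs⊆ys ys⊆xs))

product-filter-∣ : ∀ {p} {P : Pred ℕ p} (P? : Decidable P) xs → product (filter P? xs) ∣ product xs
product-filter-∣ P? [] = ∣-refl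
product-filter-∣ P? (x ∷ xs) with P? x
... | yes _ = *-monoʳ-∣ x (product-filter-∣ P? xs)
... | no _  = ∣n⇒∣m*n x (product-filter-∣ P? xs)

module _ {xs ys : List ℕ} (ys! : Unique ys) (xs! : Unique xs) (ys⊆xs : ys ⊆ xs) where

  unique∧⊆⇒↭filter : ys ↭ filter (_∈? ys) xs
  unique∧⊆⇒↭filter = unique∧⊆∧⊇⇒↭ ys! (Unique.filter⁺ (_∈? ys) xs!)
    (λ y∈ys → ∈-filter⁺ (_∈? ys) (ys⊆xs y∈ys) y∈ys)
    (λ y∈filter → proj₂ (∈-filter⁻ (_∈? ys) {xs = xs} y∈filter))

  unique∧⊆⇒length≤ : length ys ≤ length xs
  unique∧⊆⇒length≤ = ≤-trans (≤-reflexive (↭-length unique∧⊆⇒↭filter)) (length-filter (_∈? ys) xs)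

  unique∧⊆⇒product∣ : product ys ∣ product xs
  unique∧⊆⇒product∣ =
    ∣-trans (∣-reflexive (product-↭ unique∧⊆⇒↭filter)) (product-filter-∣ (_∈? ys) xs)

product*product-map≡^length : (f : ℕ → ℕ) {N : ℕ} (xs : List ℕ) →
  (∀ {x} → x ∈ xs → x * f x ≡ N) → product xs * product (map f xs) ≡ N ^ length xs
product*product-map≡^length f [] _ = refl
product*product-map≡^length f {N} (x ∷ xs) x*fx≡N = begin
  x * product xs * (f x * product (map f xs))   ≡⟨ [m*n]*[o*p]≡[m*o]*[n*p] x _ (f x) _ ⟩
  x * f x * (product xs * product (map f xs))   ≡⟨ cong₂ _*_ (x*fx≡N (here refl))
                                                     (product*product-map≡^length f xs (x*fx≡N ∘ there)) ⟩
  N * N ^ length xs                             ∎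
  where open ≡-Reasoning

module _ (f : ℕ → ℕ) {xs : List ℕ} (xs! : Unique xs)
         (f-closed : ∀ {x} → x ∈ xs → f x ∈ xs) (f-involutive : ∀ {x} → x ∈ xs → f (f x) ≡ x)
         where

  map-involution↭ : map f xs ↭ xs
  map-involution↭ = unique∧⊆∧⊇⇒↭ fxs! xs! fxs⊆xs xs⊆fxs
    where
    ff-xs : map f (map f xs) ≡ xs
    ff-xs = trans (sym (map-∘ xs)) (map-id-local (All.tabulate f-involutive))
    fxs! : Unique (map f xs)
    fxs! = Unique.map⁻ (subst Unique (sym ff-xs) xs!)
    fxs⊆xs : map f xs ⊆ xs
    fxs⊆xs y∈ with x , x∈ , refl ← ∈-map⁻ f y∈ = f-closed x∈
    xs⊆fxs : xs ⊆ map f xs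
    xs⊆fxs x∈ = subst (_∈ map f xs) (f-involutive x∈) (∈-map⁺ f (f-closed x∈))

  product²≡^length : ∀ {N} → (∀ {x} → x ∈ xs → x * f x ≡ N) → product xs ^ 2 ≡ N ^ length xs
  product²≡^length {N} x*fx≡N = begin
    product xs * (product xs * 1)        ≡⟨ cong (product xs *_) (*-identityʳ _) ⟩
    product xs * product xs              ≡⟨ cong (product xs *_) (product-↭ map-involution↭) ⟨
    product xs * product (map f xs)      ≡⟨ product*product-map≡^length f xs x*fx≡N ⟩
    N ^ length xs                        ∎
    where open ≡-Reasoning

product-map-*ˡ : ∀ m (xs : List ℕ) → product (map (m *_) xs) ≡ m ^ length xs * product xs
product-map-*ˡ m []       = refl
product-map-*ˡ m (x ∷ xs) = trans (cong (m * x *_) (product-map-*ˡ m xs))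
                                  ([m*n]*[o*p]≡[m*o]*[n*p] m x (m ^ length xs) (product xs))

length-cartesianProductWith : ∀ (f : ℕ → ℕ → ℕ) xs ys →
  length (cartesianProductWith f xs ys) ≡ length xs * length ys
length-cartesianProductWith f []       ys = refl
length-cartesianProductWith f (x ∷ xs) ys = trans (length-++ (map (f x) ys))
  (cong₂ _+_ (length-map (f x) ys) (length-cartesianProductWith f xs ys))

>1⇒nonZero : ∀ {n} → 1 < n → NonZero n
>1⇒nonZero 1<n = >-nonZero (<-trans z<s 1<n)

<-mono⇒injective : {f : ℕ → ℕ} → (∀ {i j} → i < j → f i < f j) → ∀ {i j} → f i ≡ f j → i ≡ j
<-mono⇒injective {f} f-mono {i} {j} fi≡fj with <-cmp i j
... | tri< i<j _ _ = contradiction fi≡fj (<⇒≢ (f-mono i<j))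
... | tri≈ _ i≡j _ = i≡j
... | tri> _ _ j<i = contradiction (sym fi≡fj) (<⇒≢ (f-mono j<i))

^-injectiveʳ : ∀ {m} → 1 < m → ∀ {i j} → m ^ i ≡ m ^ j → i ≡ j
^-injectiveʳ {m} 1<m = <-mono⇒injective (^-monoʳ-< m 1<m)

^-distrib-* : ∀ m n k → (m * n) ^ k ≡ m ^ k * n ^ k
^-distrib-* m n zero    = refl
^-distrib-* m n (suc k) = trans (cong (m * n *_) (^-distrib-* m n k))
                                 ([m*n]*[o*p]≡[m*o]*[n*p] m n (m ^ k) (n ^ k))

^-monoʳ-∣ : ∀ m {i j} → i ≤ j → m ^ i ∣ m ^ j
^-monoʳ-∣ m {i} {j} i≤j = divides (m ^ (j ∸ i)) (begin
  m ^ j               ≡⟨ cong (m ^_) (m∸n+n≡m i≤j) ⟨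
  m ^ (j ∸ i + i)     ≡⟨ ^-distribˡ-+-* m (j ∸ i) i ⟩
  m ^ (j ∸ i) * m ^ i ∎)
  where open ≡-Reasoning

m∣m^n : ∀ m {n} → 0 < n → m ∣ m ^ n
m∣m^n m {suc n} _ = m∣m*n (m ^ n)

^-∣⇒≤ʳ : ∀ {m} → 1 < m → ∀ {i j} → m ^ i ∣ m ^ j → i ≤ j
^-∣⇒≤ʳ {m} 1<m {i} {j} mⁱ∣mʲ =
  ≮⇒≥ (λ j<i → <⇒≱ (^-monoʳ-< m 1<m j<i) (∣⇒≤ {{m^n≢0 m j {{m≢0}}}} mⁱ∣mʲ))
  where m≢0 = >1⇒nonZero 1<m

prime⇒1< : ∀ {p} → Prime p → 1 < p
prime⇒1< {p} p-prime = nonTrivial⇒n>1 p {{prime⇒nonTrivial p-prime}}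

coprime-∣ʳ : ∀ {m n d} → Coprime m n → d ∣ n → Coprime m d
coprime-∣ʳ m⊥n d∣n (i∣m , i∣d) = m⊥n (i∣m , ∣-trans i∣d d∣n)

coprime-*ˡ : ∀ {m n o} → Coprime m o → Coprime n o → Coprime (m * n) o
coprime-*ˡ m⊥o n⊥o (i∣mn , i∣o) =
  n⊥o (coprime-divisor (Coprime.sym (coprime-∣ʳ m⊥o i∣o)) i∣mn , i∣o)

coprime-^ˡ : ∀ {m n} k → Coprime m n → Coprime (m ^ k) n
coprime-^ˡ zero    _   (i∣1 , _) = ∣1⇒≡1 i∣1
coprime-^ˡ (suc k) m⊥n = coprime-*ˡ m⊥n (coprime-^ˡ k m⊥n)

coprime-^ : ∀ {m n} i j → Coprime m n → Coprime (m ^ i) (n ^ j)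
coprime-^ i j = coprime-^ˡ i ∘ Coprime.sym ∘ coprime-^ˡ j ∘ Coprime.sym

prime∤⇒coprime : ∀ {p n} → Prime p → ¬ p ∣ n → Coprime p n
prime∤⇒coprime p-prime p∤n (i∣p , i∣n) with prime⇒irreducible p-prime i∣p
... | inj₁ i≡1    = i≡1
... | inj₂ refl   = contradiction i∣n p∤n

distinct-primes⇒coprime : ∀ {p q} → Prime p → Prime q → p ≢ q → Coprime p q
distinct-primes⇒coprime p-prime q-prime p≢q = prime∤⇒coprime p-prime λ p∣q →
  case prime⇒irreducible q-prime p∣q of λ where
    (inj₁ refl) → <-irrefl refl (prime⇒1< p-prime)
    (inj₂ p≡q)  → p≢q p≡q

PrimePowerSplit : ℕ → ℕ → Set
PrimePowerSplit p n = ∃₂ λ a r → n ≡ p ^ a * r × ¬ p ∣ r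

prime-power-split : ∀ {p} → Prime p → ∀ n → .{{NonZero n}} → PrimePowerSplit p n
prime-power-split {p} p-prime n = split n (<-wellFounded n)
  where
  split : ∀ n → .{{NonZero n}} → Acc _<_ n → PrimePowerSplit p n
  split n (acc rec) with p ∣? n
  ... | no p∤n = 0 , n , sym (+-identityʳ n) , p∤n
  ... | yes (divides q refl) = multiply-by-p (split q (rec (m<m*n q p (prime⇒1< p-prime))))
    where
    instance _ = m*n≢0⇒m≢0 q {p}
    open ≡-Reasoning
    multiply-by-p : PrimePowerSplit p q → PrimePowerSplit p (q * p)
    multiply-by-p (a , r , q≡pᵃr , p∤r) = suc a , r , (begin
      q * p             ≡⟨ cong (_* p) q≡pᵃr ⟩
      p ^ a * r * p     ≡⟨ *-comm (p ^ a * r) p ⟩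
      p * (p ^ a * r)   ≡⟨ *-assoc p (p ^ a) r ⟨
      p ^ suc a * r     ∎) , p∤r

∃-prime-divisor : ∀ {n} → 1 < n → ∃[ p ] Prime p × p ∣ n
∃-prime-divisor {n} 1<n = prime-factor (factors F) (isFactorisation F) (factorsPrime F)
  where
  F = factorise n {{>1⇒nonZero 1<n}}
  open PrimeFactorisation
  prime-factor : ∀ ps → n ≡ product ps → All Prime ps → ∃[ p ] Prime p × p ∣ n
  prime-factor []       n≡1 _ = contradiction n≡1 (>⇒≢ 1<n)
  prime-factor (p ∷ ps) n≡pΠ (p-prime ∷ _) = p , p-prime , divides (product ps) (trans n≡pΠ (*-comm p _))

∣-nonZero : ∀ {m n} → .{{NonZero n}} → m ∣ n → NonZero m
∣-nonZero (divides q refl) = m*n≢0⇒n≢0 q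

∣p^a⇒≡p^i : ∀ {p d} a → Prime p → d ∣ p ^ a → ∃[ i ] i ≤ a × d ≡ p ^ i
∣p^a⇒≡p^i {p} {d} a p-prime d∣pᵃ = from-split (prime-power-split p-prime d {{d≢0}})
  where
  d≢0 = ∣-nonZero {{m^n≢0 p a {{prime⇒nonZero p-prime}}}} d∣pᵃ
  from-split : PrimePowerSplit p d → ∃[ i ] i ≤ a × d ≡ p ^ i
  from-split (i , r , d≡pⁱr , p∤r) =
    i , ^-∣⇒≤ʳ (prime⇒1< p-prime) pⁱ∣pᵃ , trans d≡pⁱr (trans (cong (p ^ i *_) r≡1) (*-identityʳ (p ^ i)))
    where
    pⁱr∣pᵃ : p ^ i * r ∣ p ^ a
    pⁱr∣pᵃ = subst (_∣ p ^ a) d≡pⁱr d∣pᵃ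
    r≡1 : r ≡ 1
    r≡1 = ∣1⇒≡1 (coprime-divisor (Coprime.sym (coprime-^ˡ a (prime∤⇒coprime p-prime p∤r)))
                   (subst (r ∣_) (sym (*-identityʳ (p ^ a))) (∣-trans (n∣m*n (p ^ i)) pⁱr∣pᵃ)))
    pⁱ∣pᵃ : p ^ i ∣ p ^ a
    pⁱ∣pᵃ = ∣-trans (m∣m*n r) pⁱr∣pᵃ

p^i∣p^a*q^b⇒i≤a : ∀ {p q} → Prime p → Prime q → p ≢ q → ∀ {i} a b → p ^ i ∣ p ^ a * q ^ b → i ≤ a
p^i∣p^a*q^b⇒i≤a {p} {q} p-prime q-prime p≢q {i} a b pⁱ∣pᵃqᵇ = ^-∣⇒≤ʳ (prime⇒1< p-prime)
  (coprime-divisor (coprime-^ i b (distinct-primes⇒coprime p-prime q-prime p≢q))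
                   (subst (p ^ i ∣_) (*-comm (p ^ a) (q ^ b)) pⁱ∣pᵃqᵇ))

∣p^a*q^b⇒≡p^i*q^j : ∀ {p q e} a b → Prime p → Prime q → p ≢ q → e ∣ p ^ a * q ^ b →
                    ∃₂ λ i j → i ≤ a × j ≤ b × e ≡ p ^ i * q ^ j
∣p^a*q^b⇒≡p^i*q^j {p} {q} {e} a b p-prime q-prime p≢q e∣pᵃqᵇ =
  from-split (prime-power-split p-prime e {{e≢0}})
  where
  instance _ = prime⇒nonZero p-prime
           _ = prime⇒nonZero q-prime
  e≢0 = ∣-nonZero {{m*n≢0 (p ^ a) (q ^ b) {{m^n≢0 p a}} {{m^n≢0 q b}}}} e∣pᵃqᵇ
  from-split : PrimePowerSplit p e → ∃₂ λ i j → i ≤ a × j ≤ b × e ≡ p ^ i * q ^ j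
  from-split (i , r , e≡pⁱr , p∤r) = with-r≡qʲ (∣p^a⇒≡p^i b q-prime r∣qᵇ)
    where
    pⁱr∣pᵃqᵇ : p ^ i * r ∣ p ^ a * q ^ b
    pⁱr∣pᵃqᵇ = subst (_∣ p ^ a * q ^ b) e≡pⁱr e∣pᵃqᵇ
    r∣qᵇ : r ∣ q ^ b
    r∣qᵇ = coprime-divisor (Coprime.sym (coprime-^ˡ a (prime∤⇒coprime p-prime p∤r)))
                           (∣-trans (n∣m*n (p ^ i)) pⁱr∣pᵃqᵇ)
    with-r≡qʲ : ∃[ j ] j ≤ b × r ≡ q ^ j → ∃₂ λ i j → i ≤ a × j ≤ b × e ≡ p ^ i * q ^ j
    with-r≡qʲ (j , j≤b , r≡qʲ) =
      i , j , p^i∣p^a*q^b⇒i≤a p-prime q-prime p≢q a b (∣-trans (m∣m*n r) pⁱr∣pᵃqᵇ) , j≤b ,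
      trans e≡pⁱr (cong (p ^ i *_) r≡qʲ)

τ : ℕ → ℕ
τ m = length (divisors m)

τ* : ℕ → ℕ
τ* n = length (unitaryDivisors n)

infix 4 _∥_
_∥_ : ℕ → ℕ → Set
d ∥ n = ∃[ e ] d * e ≡ n × Coprime d e

∈-divisors⁻ : ∀ {d m} → d ∈ divisors m → d ∣ m
∈-divisors⁻ {m = m} d∈ = proj₂ (∈-filter⁻ (_∣? m) {xs = map suc (upTo m)} d∈)

∈-divisors⁺ : ∀ {d m} → .{{NonZero m}} → d ∣ m → d ∈ divisors m
∈-divisors⁺ {zero}  {m} d∣m = contradiction (0∣⇒≡0 d∣m) (≢-nonZero⁻¹ m)
∈-divisors⁺ {suc d} {m} d∣m = ∈-filter⁺ (_∣? m) (∈-map⁺ suc (∈-upTo⁺ (∣⇒≤ d∣m))) d∣m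

divisors-unique : ∀ m → Unique (divisors m)
divisors-unique m = Unique.filter⁺ (_∣? m) (Unique.map⁺ suc-injective (Unique.upTo⁺ m))

∥⇒∣ : ∀ {d n} → d ∥ n → d ∣ n
∥⇒∣ (e , d*e≡n , _) = divides e (trans (sym d*e≡n) (*-comm _ e))

∥-sym : ∀ {d e n} → d * e ≡ n → Coprime d e → e ∥ n
∥-sym {d} {e} d*e≡n d⊥e = d , trans (*-comm e d) d*e≡n , Coprime.sym d⊥e

-- n / d, with the junk value 0 at d = 0 so that no NonZero instance is needed
codivisor : ℕ → ℕ → ℕ
codivisor n zero    = 0
codivisor n (suc d) = n / suc d

codivisor-* : ∀ {n} d e → .{{NonZero n}} → d * e ≡ n → codivisor n d ≡ e
codivisor-* {n} zero    e 0≡n  = contradiction (sym 0≡n) (≢-nonZero⁻¹ n)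
codivisor-*     (suc d) e refl = trans (cong (_/ suc d) (*-comm (suc d) e)) (m*n/n≡m e (suc d))

unitary? : ∀ n → Decidable (λ i → suc i ∣ n × Coprime (suc i) (n / suc i))
unitary? n i = (suc i ∣? n) ×-dec coprime? (suc i) (n / suc i)

∈-unitaryDivisors⁻ : ∀ {d n} → d ∈ unitaryDivisors n → d ∥ n
∈-unitaryDivisors⁻ {n = n} d∈ with i , i∈ , refl ← ∈-map⁻ suc d∈
  with _ , (i+1∣n , i+1⊥n/[i+1]) ← ∈-filter⁻ (unitary? n) {xs = upTo n} i∈
  = n / suc i , m*[n/m]≡n i+1∣n , i+1⊥n/[i+1]

∈-unitaryDivisors⁺ : ∀ {d n} → .{{NonZero n}} → d ∥ n → d ∈ unitaryDivisors n
∈-unitaryDivisors⁺ {zero}  {n} (e , 0≡n , _) = contradiction (sym 0≡n) (≢-nonZero⁻¹ n)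
∈-unitaryDivisors⁺ {suc i} {n} d∥n@(e , d*e≡n , d⊥e) =
  ∈-map⁺ suc (∈-filter⁺ (unitary? n) (∈-upTo⁺ (∣⇒≤ d∣n)) (d∣n , d⊥n/d))
  where
  d∣n = ∥⇒∣ d∥n
  d⊥n/d = subst (Coprime (suc i)) (sym (codivisor-* (suc i) e d*e≡n)) d⊥e

unitaryDivisors-unique : ∀ n → Unique (unitaryDivisors n)
unitaryDivisors-unique n = Unique.map⁺ suc-injective (Unique.filter⁺ (unitary? n) (Unique.upTo⁺ n))

complementary-pairing : ∀ {m} .{{_ : NonZero m}} {xs : List ℕ} → Unique xs →
  (∀ {d} → d ∈ xs → ∃[ e ] d * e ≡ m × e ∈ xs) → product xs ^ 2 ≡ m ^ length xs
complementary-pairing {m} {xs} xs! complement =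
  product²≡^length (codivisor m) xs! closed involutive λ {d} d∈ → d*codivisor≡m d (complement d∈)
  where
  d*codivisor≡m : ∀ d → ∃[ e ] d * e ≡ m × e ∈ xs → d * codivisor m d ≡ m
  d*codivisor≡m d (e , d*e≡m , _) = trans (cong (d *_) (codivisor-* d e d*e≡m)) d*e≡m
  closed : ∀ {d} → d ∈ xs → codivisor m d ∈ xs
  closed {d} d∈ with e , d*e≡m , e∈ ← complement d∈ = subst (_∈ xs) (sym (codivisor-* d e d*e≡m)) e∈
  involutive : ∀ {d} → d ∈ xs → codivisor m (codivisor m d) ≡ d
  involutive {d} d∈ with e , d*e≡m , _ ← complement d∈ =
    trans (cong (codivisor m) (codivisor-* d e d*e≡m)) (codivisor-* e d (trans (*-comm e d) d*e≡m))

Tdiv²≡^τ : ∀ m → .{{NonZero m}} → Tdiv m ^ 2 ≡ m ^ τ m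
Tdiv²≡^τ m = complementary-pairing (divisors-unique m) λ d∈ → complement (∈-divisors⁻ d∈)
  where
  complement : ∀ {d} → d ∣ m → ∃[ e ] d * e ≡ m × e ∈ divisors m
  complement {d} (divides e m≡e*d) =
    e , trans (*-comm d e) (sym m≡e*d) , ∈-divisors⁺ (divides d (trans m≡e*d (*-comm e d)))

Tstar²≡^τ* : ∀ n → .{{NonZero n}} → Tstar n ^ 2 ≡ n ^ τ* n
Tstar²≡^τ* n = complementary-pairing (unitaryDivisors-unique n) λ d∈ → complement (∈-unitaryDivisors⁻ d∈)
  where
  complement : ∀ {d} → d ∥ n → ∃[ e ] d * e ≡ n × e ∈ unitaryDivisors n
  complement (e , d*e≡n , d⊥e) = e , d*e≡n , ∈-unitaryDivisors⁺ (∥-sym d*e≡n d⊥e)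

Tstar≢0 : ∀ n → .{{NonZero n}} → NonZero (Tstar n)
Tstar≢0 n = ≢-nonZero λ T*n≡0 → ≢-nonZero⁻¹ (n ^ τ* n) {{m^n≢0 n (τ* n)}}
  (trans (sym (Tstar²≡^τ* n)) (cong (_^ 2) T*n≡0))

τ*[n]*τ[T*n]≡k*4 : ∀ {n k} → 1 < n → Tdiv (Tstar n) ≡ n ^ k → τ* n * τ (Tstar n) ≡ k * 4
τ*[n]*τ[T*n]≡k*4 {n} {k} 1<n T[T*n]≡nᵏ = sym (^-injectiveʳ 1<n (begin
  n ^ (k * 4)                ≡⟨ ^-*-assoc n k 4 ⟨
  (n ^ k) ^ 4                ≡⟨ cong (_^ 4) T[T*n]≡nᵏ ⟨
  Tdiv m ^ (2 * 2)           ≡⟨ ^-*-assoc (Tdiv m) 2 2 ⟨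
  (Tdiv m ^ 2) ^ 2           ≡⟨ cong (_^ 2) (Tdiv²≡^τ m) ⟩
  (m ^ τ m) ^ 2              ≡⟨ ^-*-assoc m (τ m) 2 ⟩
  m ^ (τ m * 2)              ≡⟨ cong (m ^_) (*-comm (τ m) 2) ⟩
  m ^ (2 * τ m)              ≡⟨ ^-*-assoc m 2 (τ m) ⟨
  (m ^ 2) ^ τ m              ≡⟨ cong (_^ τ m) (Tstar²≡^τ* n) ⟩
  (n ^ τ* n) ^ τ m           ≡⟨ ^-*-assoc n (τ* n) (τ m) ⟩
  n ^ (τ* n * τ m)           ∎))
  where
  open ≡-Reasoning
  m = Tstar n
  instance
    n≢0 : NonZero n
    n≢0 = >1⇒nonZero 1<n
    m≢0 : NonZero m
    m≢0 = Tstar≢0 n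

1∥n : ∀ n → 1 ∥ n
1∥n n = n , *-identityˡ n , Coprime.1-coprimeTo n

n∥n : ∀ n → n ∥ n
n∥n n = ∥-sym (*-identityˡ n) (Coprime.1-coprimeTo n)

module _ {n} (1<n : 1 < n) where
  private instance _ = >1⇒nonZero 1<n

  [1,n]-unique : Unique (1 ∷ n ∷ [])
  [1,n]-unique = ((λ 1≡n → <-irrefl 1≡n 1<n) ∷ []) ∷ [] ∷ []

  [1,n]⊆unitaryDivisors : (1 ∷ n ∷ []) ⊆ unitaryDivisors n
  [1,n]⊆unitaryDivisors (here refl)         = ∈-unitaryDivisors⁺ (1∥n n)
  [1,n]⊆unitaryDivisors (there (here refl)) = ∈-unitaryDivisors⁺ (n∥n n)

  2≤τ* : 2 ≤ τ* n
  2≤τ* = unique∧⊆⇒length≤ [1,n]-unique (unitaryDivisors-unique n) [1,n]⊆unitaryDivisors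

τ*[p^a]≡2 : ∀ {p a} → Prime p → 0 < a → τ* (p ^ a) ≡ 2
τ*[p^a]≡2 {p} {a} p-prime 0<a = ≤-antisym
  (unique∧⊆⇒length≤ (unitaryDivisors-unique (p ^ a)) ([1,n]-unique 1<pᵃ) (trivial ∘ ∈-unitaryDivisors⁻))
  (2≤τ* 1<pᵃ)
  where
  1<pᵃ : 1 < p ^ a
  1<pᵃ = ^-monoʳ-< p (prime⇒1< p-prime) 0<a
  trivial : ∀ {d} → d ∥ p ^ a → d ∈ 1 ∷ p ^ a ∷ []
  trivial {d} d∥pᵃ@(e , d*e≡pᵃ , d⊥e)
    with ∣p^a⇒≡p^i a p-prime (∥⇒∣ d∥pᵃ) | ∣p^a⇒≡p^i a p-prime (∥⇒∣ (∥-sym d*e≡pᵃ d⊥e))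
  ... | zero  , _ , d≡1  | _                = here d≡1
  ... | _                | zero  , _ , e≡1  =
    there (here (trans (sym (*-identityʳ d)) (trans (cong (d *_) (sym e≡1)) d*e≡pᵃ)))
  ... | suc i , _ , d≡pⁱ | suc j , _ , e≡pʲ =
    contradiction (d⊥e (p∣ i d≡pⁱ , p∣ j e≡pʲ)) (>⇒≢ (prime⇒1< p-prime))
    where
    p∣ : ∀ {x} k → x ≡ p ^ suc k → p ∣ x
    p∣ k x≡p^[1+k] = subst (p ∣_) (sym x≡p^[1+k]) (m∣m^n p {suc k} z<s)

module _ {m n} (1<m : 1 < m) (m⊥n : Coprime m n) .{{_ : NonZero n}} where
  private
    instance
      m≢0 : NonZero m
      m≢0 = >1⇒nonZero 1<m
      mn≢0 : NonZero (m * n)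
      mn≢0 = m*n≢0 m n

    doubled : List ℕ
    doubled = unitaryDivisors n ++ map (m *_) (unitaryDivisors n)

    ∥-*ʳ : ∀ {d} → d ∥ n → d ∥ m * n
    ∥-*ʳ {d} (e , d*e≡n , d⊥e) =
      m * e , trans (x∙yz≈y∙xz d m e) (cong (m *_) d*e≡n) ,
      Coprime.sym (coprime-*ˡ (coprime-∣ʳ m⊥n (∥⇒∣ (e , d*e≡n , d⊥e))) (Coprime.sym d⊥e))

    m*∥-*ˡ : ∀ {d} → d ∥ n → m * d ∥ m * n
    m*∥-*ˡ {d} (e , d*e≡n , d⊥e) =
      e , trans (*-assoc m d e) (cong (m *_) d*e≡n) ,
      coprime-*ˡ (coprime-∣ʳ m⊥n (∥⇒∣ (∥-sym d*e≡n d⊥e))) d⊥e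

    doubled-unique : Unique doubled
    doubled-unique = Unique.++⁺ (unitaryDivisors-unique n)
      (Unique.map⁺ (*-cancelˡ-≡ _ _ m) (unitaryDivisors-unique n)) not-both
      where
      not-both : ∀ {d} → ¬ (d ∈ unitaryDivisors n × d ∈ map (m *_) (unitaryDivisors n))
      not-both (d∈ , md′∈) with d′ , _ , refl ← ∈-map⁻ (m *_) md′∈ =
        <-irrefl (sym (m⊥n (∣-refl , ∣-trans (m∣m*n d′) (∥⇒∣ (∈-unitaryDivisors⁻ d∈))))) 1<m

    doubled⊆unitaryDivisors : doubled ⊆ unitaryDivisors (m * n)
    doubled⊆unitaryDivisors d∈ with ∈-++⁻ (unitaryDivisors n) d∈
    ... | inj₁ d∈ud = ∈-unitaryDivisors⁺ (∥-*ʳ (∈-unitaryDivisors⁻ d∈ud))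
    ... | inj₂ d∈md with d′ , d′∈ , refl ← ∈-map⁻ (m *_) d∈md =
      ∈-unitaryDivisors⁺ (m*∥-*ˡ (∈-unitaryDivisors⁻ d′∈))

  τ*+τ*≤τ*[m*n] : τ* n + τ* n ≤ τ* (m * n)
  τ*+τ*≤τ*[m*n] = begin
    τ* n + τ* n                                     ≡⟨ cong (τ* n +_) (length-map (m *_) (unitaryDivisors n)) ⟨
    τ* n + length (map (m *_) (unitaryDivisors n))  ≡⟨ length-++ (unitaryDivisors n) ⟨
    length doubled                                  ≤⟨ unique∧⊆⇒length≤ doubled-unique
                                                         (unitaryDivisors-unique (m * n)) doubled⊆unitaryDivisors ⟩
    τ* (m * n)                                      ∎
    where open ≤-Reasoning

  [m*n]^τ*∣Tstar[m*n] : (m * n) ^ τ* n ∣ Tstar (m * n)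
  [m*n]^τ*∣Tstar[m*n] = subst (_∣ Tstar (m * n)) product-doubled
    (unique∧⊆⇒product∣ doubled-unique (unitaryDivisors-unique (m * n)) doubled⊆unitaryDivisors)
    where
    open ≡-Reasoning
    U = unitaryDivisors n
    product-doubled : product doubled ≡ (m * n) ^ τ* n
    product-doubled = begin
      product doubled                     ≡⟨ product-++ U (map (m *_) U) ⟩
      Tstar n * product (map (m *_) U)    ≡⟨ cong (Tstar n *_) (product-map-*ˡ m U) ⟩
      Tstar n * (m ^ τ* n * Tstar n)      ≡⟨ x∙yz≈y∙xz (Tstar n) (m ^ τ* n) (Tstar n) ⟩
      m ^ τ* n * (Tstar n * Tstar n)      ≡⟨ cong (λ t → m ^ τ* n * (Tstar n * t)) (*-identityʳ (Tstar n)) ⟨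
      m ^ τ* n * Tstar n ^ 2              ≡⟨ cong (m ^ τ* n *_) (Tstar²≡^τ* n) ⟩
      m ^ τ* n * n ^ τ* n                 ≡⟨ ^-distrib-* m n (τ* n) ⟨
      (m * n) ^ τ* n                      ∎

τ≡length : ∀ {m} .{{_ : NonZero m}} {xs : List ℕ} → Unique xs →
           (∀ {d} → d ∣ m → d ∈ xs) → (∀ {d} → d ∈ xs → d ∣ m) → τ m ≡ length xs
τ≡length {m} xs! ∣⇒∈ ∈⇒∣ = ↭-length (unique∧⊆∧⊇⇒↭ (divisors-unique m) xs!
  (∣⇒∈ ∘ ∈-divisors⁻) (∈-divisors⁺ ∘ ∈⇒∣))

τ-mono-∣ : ∀ {m n} .{{_ : NonZero n}} → m ∣ n → τ m ≤ τ n
τ-mono-∣ {m} {n} m∣n = unique∧⊆⇒length≤ (divisors-unique m) (divisors-unique n)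
  λ d∈ → ∈-divisors⁺ (∣-trans (∈-divisors⁻ d∈) m∣n)

τ[p^a]≡1+a : ∀ {p} a → Prime p → τ (p ^ a) ≡ suc a
τ[p^a]≡1+a {p} a p-prime = begin
  τ (p ^ a)                           ≡⟨ τ≡length powers-unique ∣⇒∈ ∈⇒∣ ⟩
  length (map (p ^_) (upTo (suc a)))  ≡⟨ length-map (p ^_) (upTo (suc a)) ⟩
  length (upTo (suc a))               ≡⟨ length-upTo (suc a) ⟩
  suc a                               ∎
  where
  open ≡-Reasoning
  instance _ = m^n≢0 p a {{prime⇒nonZero p-prime}}
  powers-unique : Unique (map (p ^_) (upTo (suc a)))
  powers-unique = Unique.map⁺ (^-injectiveʳ (prime⇒1< p-prime)) (Unique.upTo⁺ (suc a))
  ∣⇒∈ : ∀ {d} → d ∣ p ^ a → d ∈ map (p ^_) (upTo (suc a))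
  ∣⇒∈ d∣pᵃ with i , i≤a , refl ← ∣p^a⇒≡p^i a p-prime d∣pᵃ =
    ∈-map⁺ (p ^_) (∈-upTo⁺ (s≤s i≤a))
  ∈⇒∣ : ∀ {d} → d ∈ map (p ^_) (upTo (suc a)) → d ∣ p ^ a
  ∈⇒∣ d∈ with i , i∈ , refl ← ∈-map⁻ (p ^_) d∈ = ^-monoʳ-∣ p (s≤s⁻¹ (∈-upTo⁻ i∈))

τ[p^a*q^b]≡[1+a]*[1+b] : ∀ {p q} a b → Prime p → Prime q → p ≢ q → τ (p ^ a * q ^ b) ≡ suc a * suc b
τ[p^a*q^b]≡[1+a]*[1+b] {p} {q} a b p-prime q-prime p≢q = begin
  τ (p ^ a * q ^ b)   ≡⟨ τ≡length grid-unique ∣⇒∈ ∈⇒∣ ⟩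
  length grid         ≡⟨ length-cartesianProductWith pq^ (upTo (suc a)) (upTo (suc b)) ⟩
  length (upTo (suc a)) * length (upTo (suc b)) ≡⟨ cong₂ _*_ (length-upTo (suc a)) (length-upTo (suc b)) ⟩
  suc a * suc b       ∎
  where
  open ≡-Reasoning
  instance
    _ = prime⇒nonZero p-prime
    _ = prime⇒nonZero q-prime
    _ = m*n≢0 (p ^ a) (q ^ b) {{m^n≢0 p a}} {{m^n≢0 q b}}
  pq^ : ℕ → ℕ → ℕ
  pq^ i j = p ^ i * q ^ j
  grid : List ℕ
  grid = cartesianProductWith pq^ (upTo (suc a)) (upTo (suc b))
  exponents-≤ : ∀ {i i′ j j′} → pq^ i j ≡ pq^ i′ j′ → i ≤ i′ × j ≤ j′
  exponents-≤ {i} {i′} {j} {j′} eq =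
    p^i∣p^a*q^b⇒i≤a p-prime q-prime p≢q i′ j′ (subst (p ^ i ∣_) eq (m∣m*n (q ^ j))) ,
    p^i∣p^a*q^b⇒i≤a q-prime p-prime (p≢q ∘ sym) j′ i′
      (subst (q ^ j ∣_) (trans eq (*-comm (p ^ i′) (q ^ j′))) (n∣m*n (p ^ i)))
  pq^-injective : ∀ {i i′ j j′} → pq^ i j ≡ pq^ i′ j′ → i ≡ i′ × j ≡ j′
  pq^-injective eq with i≤i′ , j≤j′ ← exponents-≤ eq | i′≤i , j′≤j ← exponents-≤ (sym eq) =
    ≤-antisym i≤i′ i′≤i , ≤-antisym j≤j′ j′≤j
  grid-unique : Unique grid
  grid-unique = Unique.cartesianProductWith⁺ pq^ pq^-injective (Unique.upTo⁺ (suc a)) (Unique.upTo⁺ (suc b))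
  ∣⇒∈ : ∀ {d} → d ∣ p ^ a * q ^ b → d ∈ grid
  ∣⇒∈ d∣ with i , j , i≤a , j≤b , refl ← ∣p^a*q^b⇒≡p^i*q^j a b p-prime q-prime p≢q d∣ =
    ∈-cartesianProductWith⁺ pq^ (∈-upTo⁺ (s≤s i≤a)) (∈-upTo⁺ (s≤s j≤b))
  ∈⇒∣ : ∀ {d} → d ∈ grid → d ∣ p ^ a * q ^ b
  ∈⇒∣ d∈ with i , j , i∈ , j∈ , refl ← ∈-cartesianProductWith⁻ pq^ (upTo (suc a)) (upTo (suc b)) d∈ =
    *-pres-∣ (^-monoʳ-∣ p (s≤s⁻¹ (∈-upTo⁻ i∈))) (^-monoʳ-∣ q (s≤s⁻¹ (∈-upTo⁻ j∈)))

module TwoPrimeFactors {p q a b s k} (p-prime : Prime p) (q-prime : Prime q) (0<a : 0 < a) (0<b : 0 < b)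
         (p∤qᵇs : ¬ p ∣ q ^ b * s) (q∤s : ¬ q ∣ s) (k≤10 : k ≤ 10)
         (perfect : Tdiv (Tstar (p ^ a * (q ^ b * s))) ≡ (p ^ a * (q ^ b * s)) ^ k) where

  p≢q : p ≢ q
  p≢q refl = p∤qᵇs (∣-trans (m∣m^n p 0<b) (m∣m*n s))

  private
    n = p ^ a * (q ^ b * s)

    instance
      p≢0 : NonZero p
      p≢0 = prime⇒nonZero p-prime
      q≢0 : NonZero q
      q≢0 = prime⇒nonZero q-prime
      s≢0 : NonZero s
      s≢0 = ≢-nonZero λ { refl → p∤qᵇs (subst (p ∣_) (sym (*-zeroʳ (q ^ b))) (p ∣0)) }
      qᵇs≢0 : NonZero (q ^ b * s)
      qᵇs≢0 = m*n≢0 (q ^ b) s {{m^n≢0 q b}}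
      n≢0 : NonZero n
      n≢0 = m*n≢0 (p ^ a) (q ^ b * s) {{m^n≢0 p a}}
      T*n≢0 : NonZero (Tstar n)
      T*n≢0 = Tstar≢0 n

    1<pᵃ : 1 < p ^ a
    1<pᵃ = ^-monoʳ-< p (prime⇒1< p-prime) 0<a
    1<qᵇ : 1 < q ^ b
    1<qᵇ = ^-monoʳ-< q (prime⇒1< q-prime) 0<b
    1<qᵇs : 1 < q ^ b * s
    1<qᵇs = <-≤-trans 1<qᵇ (m≤m*n (q ^ b) s)
    pᵃ⊥qᵇs : Coprime (p ^ a) (q ^ b * s)
    pᵃ⊥qᵇs = coprime-^ˡ a (prime∤⇒coprime p-prime p∤qᵇs)

    identity : τ* n * τ (Tstar n) ≡ k * 4
    identity = τ*[n]*τ[T*n]≡k*4 {n} {k} (<-≤-trans 1<pᵃ (m≤m*n (p ^ a) (q ^ b * s))) perfect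

    excluded : ∀ U D → U ≤ τ* n → D ≤ τ (Tstar n) → {True (40 <? U * D)} → ∀ {A : Set} → A
    excluded U D U≤τ*n D≤τ[T*n] {40<U*D} = contradiction (begin
      U * D               ≤⟨ *-mono-≤ U≤τ*n D≤τ[T*n] ⟩
      τ* n * τ (Tstar n)  ≡⟨ identity ⟩
      k * 4               ≤⟨ *-monoˡ-≤ 4 k≤10 ⟩
      40                  ∎) (<⇒≱ (toWitness 40<U*D))
      where open ≤-Reasoning

    4≤τ*n : 4 ≤ τ* n
    4≤τ*n = ≤-trans (+-mono-≤ (2≤τ* 1<qᵇs) (2≤τ* 1<qᵇs)) (τ*+τ*≤τ*[m*n] 1<pᵃ pᵃ⊥qᵇs)

    n²∣T*n : n ^ 2 ∣ Tstar n
    n²∣T*n = ∣-trans (^-monoʳ-∣ n (2≤τ* 1<qᵇs)) ([m*n]^τ*∣Tstar[m*n] 1<pᵃ pᵃ⊥qᵇs)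

    p^[2a]*q^[2b]∣n² : p ^ (a * 2) * q ^ (b * 2) ∣ n ^ 2
    p^[2a]*q^[2b]∣n² = divides (s ^ 2) (begin
      (p ^ a * (q ^ b * s)) ^ 2            ≡⟨ ^-distrib-* (p ^ a) (q ^ b * s) 2 ⟩
      (p ^ a) ^ 2 * (q ^ b * s) ^ 2        ≡⟨ cong ((p ^ a) ^ 2 *_) (^-distrib-* (q ^ b) s 2) ⟩
      (p ^ a) ^ 2 * ((q ^ b) ^ 2 * s ^ 2)  ≡⟨ *-assoc ((p ^ a) ^ 2) _ _ ⟨
      (p ^ a) ^ 2 * (q ^ b) ^ 2 * s ^ 2    ≡⟨ cong₂ (λ x y → x * y * s ^ 2)
                                                 (^-*-assoc p a 2) (^-*-assoc q b 2) ⟩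
      p ^ (a * 2) * q ^ (b * 2) * s ^ 2    ≡⟨ *-comm _ (s ^ 2) ⟩
      s ^ 2 * (p ^ (a * 2) * q ^ (b * 2))  ∎)
      where open ≡-Reasoning

    [1+i]*[1+j]≤τ[T*n] : ∀ i j → i ≤ a * 2 → j ≤ b * 2 → suc i * suc j ≤ τ (Tstar n)
    [1+i]*[1+j]≤τ[T*n] i j i≤2a j≤2b = begin
      suc i * suc j        ≡⟨ τ[p^a*q^b]≡[1+a]*[1+b] i j p-prime q-prime p≢q ⟨
      τ (p ^ i * q ^ j)    ≤⟨ τ-mono-∣ (∣-trans pⁱqʲ∣p^[2a]*q^[2b] p^[2a]*q^[2b]∣T*n) ⟩
      τ (Tstar n)          ∎
      where
      open ≤-Reasoning
      pⁱqʲ∣p^[2a]*q^[2b] = *-pres-∣ (^-monoʳ-∣ p i≤2a) (^-monoʳ-∣ q j≤2b)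
      p^[2a]*q^[2b]∣T*n = ∣-trans p^[2a]*q^[2b]∣n² n²∣T*n

    9≤τ[T*n] : 9 ≤ τ (Tstar n)
    9≤τ[T*n] = [1+i]*[1+j]≤τ[T*n] 2 2 (*-monoˡ-≤ 2 0<a) (*-monoˡ-≤ 2 0<b)

  s≡1 : s ≡ 1
  s≡1 with s ≟ 1
  ... | yes s≡1 = s≡1
  ... | no s≢1  = excluded 8 9 8≤τ*n 9≤τ[T*n]
    where
    1<s : 1 < s
    1<s = ≤∧≢⇒< (>-nonZero⁻¹ s) (s≢1 ∘ sym)
    4≤τ*[qᵇs] : 4 ≤ τ* (q ^ b * s)
    4≤τ*[qᵇs] = ≤-trans (+-mono-≤ (2≤τ* 1<s) (2≤τ* 1<s))
                        (τ*+τ*≤τ*[m*n] 1<qᵇ (coprime-^ˡ b (prime∤⇒coprime q-prime q∤s)))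
    8≤τ*n : 8 ≤ τ* n
    8≤τ*n = ≤-trans (+-mono-≤ 4≤τ*[qᵇs] 4≤τ*[qᵇs]) (τ*+τ*≤τ*[m*n] 1<pᵃ pᵃ⊥qᵇs)

  a≡1 : a ≡ 1
  a≡1 with a ≟ 1
  ... | yes a≡1 = a≡1
  ... | no a≢1  = excluded 4 15 4≤τ*n
    ([1+i]*[1+j]≤τ[T*n] 4 2 (*-monoˡ-≤ 2 (≤∧≢⇒< 0<a (a≢1 ∘ sym))) (*-monoˡ-≤ 2 0<b))

  b≡1 : b ≡ 1
  b≡1 with b ≟ 1
  ... | yes b≡1 = b≡1
  ... | no b≢1  = excluded 4 15 4≤τ*n
    ([1+i]*[1+j]≤τ[T*n] 2 4 (*-monoˡ-≤ 2 0<a) (*-monoˡ-≤ 2 (≤∧≢⇒< 0<b (b≢1 ∘ sym))))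

  n≡p*q : n ≡ p * q
  n≡p*q = begin
    p ^ a * (q ^ b * s)   ≡⟨ cong₂ (λ x y → p ^ x * (q ^ y * s)) a≡1 b≡1 ⟩
    p * 1 * (q * 1 * s)   ≡⟨ cong₂ (λ x y → x * (y * s)) (*-identityʳ p) (*-identityʳ q) ⟩
    p * (q * s)           ≡⟨ cong (λ y → p * (q * y)) s≡1 ⟩
    p * (q * 1)           ≡⟨ cong (p *_) (*-identityʳ q) ⟩
    p * q                 ∎
    where open ≡-Reasoning

  k≡9 : k ≡ 9
  k≡9 = *-cancelʳ-≡ k 9 4 (begin
    k * 4                  ≡⟨ identity ⟨
    τ* n * τ (Tstar n)     ≡⟨ cong₂ _*_ τ*n≡4 (cong τ T*n≡p²q²) ⟩
    4 * τ (p ^ 2 * q ^ 2)  ≡⟨ cong (4 *_) (τ[p^a*q^b]≡[1+a]*[1+b] 2 2 p-prime q-prime p≢q) ⟩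
    9 * 4                  ∎)
    where
    open ≡-Reasoning
    τ*n≡4 : τ* n ≡ 4
    τ*n≡4 with 5 ≤? τ* n
    ... | yes 5≤τ*n = excluded 5 9 5≤τ*n 9≤τ[T*n]
    ... | no 5≰τ*n  = ≤-antisym (s≤s⁻¹ (≰⇒> 5≰τ*n)) 4≤τ*n
    T*n≡p²q² : Tstar n ≡ p ^ 2 * q ^ 2
    T*n≡p²q² = begin
      Tstar n        ≡⟨ <-mono⇒injective (^-monoˡ-< 2) (begin
                          Tstar n ^ 2   ≡⟨ Tstar²≡^τ* n ⟩
                          n ^ τ* n      ≡⟨ cong (n ^_) τ*n≡4 ⟩
                          n ^ (2 * 2)   ≡⟨ ^-*-assoc n 2 2 ⟨
                          (n ^ 2) ^ 2   ∎) ⟩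
      n ^ 2          ≡⟨ cong (_^ 2) n≡p*q ⟩
      (p * q) ^ 2    ≡⟨ ^-distrib-* p q 2 ⟩
      p ^ 2 * q ^ 2  ∎

prime-power-case : ∀ {p a k} → Prime p → 0 < a → Tdiv (Tstar (p ^ a)) ≡ (p ^ a) ^ k → k + k ∸ 1 ≡ a
prime-power-case {p} {a} {k} p-prime 0<a perfect = cong (_∸ 1) (*-cancelʳ-≡ (k + k) (suc a) 2 (begin
  (k + k) * 2                ≡⟨ [k+k]*2≡k*4 k ⟩
  k * 4                      ≡⟨ τ*[n]*τ[T*n]≡k*4 {k = k} 1<pᵃ perfect ⟨
  τ* (p ^ a) * τ (Tstar (p ^ a)) ≡⟨ cong₂ _*_ (τ*[p^a]≡2 p-prime 0<a) (cong τ T*n≡n) ⟩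
  2 * τ (p ^ a)              ≡⟨ cong (2 *_) (τ[p^a]≡1+a a p-prime) ⟩
  2 * suc a                  ≡⟨ *-comm 2 (suc a) ⟩
  suc a * 2                  ∎))
  where
  open ≡-Reasoning
  instance _ = m^n≢0 p a {{prime⇒nonZero p-prime}}
  1<pᵃ : 1 < p ^ a
  1<pᵃ = ^-monoʳ-< p (prime⇒1< p-prime) 0<a
  [k+k]*2≡k*4 : ∀ k → (k + k) * 2 ≡ k * 4
  [k+k]*2≡k*4 = solve-∀
  T*n≡n : Tstar (p ^ a) ≡ p ^ a
  T*n≡n = <-mono⇒injective (^-monoˡ-< 2)
    (trans (Tstar²≡^τ* (p ^ a)) (cong ((p ^ a) ^_) (τ*[p^a]≡2 p-prime 0<a)))

two-prime-divisors-case : ∀ {p a r k} → Prime p → 0 < a → ¬ p ∣ r → 1 < r → k ≤ 10 →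
  Tdiv (Tstar (p ^ a * r)) ≡ (p ^ a * r) ^ k →
  k ≡ 9 × ∃[ p′ ] ∃[ q ] Prime p′ × Prime q × p′ ≢ q × p ^ a * r ≡ p′ * q
two-prime-divisors-case {p} {a} {r} {k} p-prime 0<a p∤r 1<r k≤10 perfect
  with q , q-prime , q∣r ← ∃-prime-divisor 1<r
  with prime-power-split q-prime r {{>1⇒nonZero 1<r}}
... | zero  , s , refl , q∤s = contradiction (subst (q ∣_) (*-identityˡ s) q∣r) q∤s
... | suc b , s , refl , q∤s = k≡9 , p , q , p-prime , q-prime , p≢q , n≡p*q
  where open TwoPrimeFactors {p} {q} {a} {suc b} {s} {k} p-prime q-prime 0<a z<s p∤r q∤s k≤10 perfect

T[T*n]≡nᵏ-classification : ∀ {n k} → 1 < n → k ≤ 10 → Tdiv (Tstar n) ≡ n ^ k →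
  (∃[ p ] Prime p × n ≡ p ^ (k + k ∸ 1)) ⊎
  (k ≡ 9 × ∃[ p ] ∃[ q ] Prime p × Prime q × p ≢ q × n ≡ p * q)
T[T*n]≡nᵏ-classification {n} {k} 1<n k≤10 perfect
  with p , p-prime , p∣n ← ∃-prime-divisor 1<n
  with prime-power-split p-prime n {{>1⇒nonZero 1<n}}
... | zero  , r , refl , p∤r = contradiction (subst (p ∣_) (*-identityˡ r) p∣n) p∤r
... | suc a , r , refl , p∤r with r ≟ 1
...   | no r≢1   = inj₂ (two-prime-divisors-case {a = suc a} p-prime z<s p∤r 1<r k≤10 perfect)
  where 1<r = ≤∧≢⇒< (>-nonZero⁻¹ r {{m*n≢0⇒n≢0 (p ^ suc a) {{>1⇒nonZero 1<n}}}}) (r≢1 ∘ sym)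
...   | yes refl = inj₁ (p , p-prime , (begin
  p ^ suc a * 1          ≡⟨ *-identityʳ (p ^ suc a) ⟩
  p ^ suc a              ≡⟨ cong (p ^_) (prime-power-case {a = suc a} {k} p-prime z<s perfect′) ⟨
  p ^ (k + k ∸ 1)        ∎))
  where
  open ≡-Reasoning
  perfect′ : Tdiv (Tstar (p ^ suc a)) ≡ (p ^ suc a) ^ k
  perfect′ = subst (λ m → Tdiv (Tstar m) ≡ m ^ k) (*-identityʳ (p ^ suc a)) perfect

theorem3p1 : (n : ℕ) → 1 < n →
    (Tdiv (Tstar n) ≡ n ^ 2 → ∃[ p ] Prime p × n ≡ p ^ 3) ×
    (Tdiv (Tstar n) ≡ n ^ 3 → ∃[ p ] Prime p × n ≡ p ^ 5) ×
    (Tdiv (Tstar n) ≡ n ^ 4 → ∃[ p ] Prime p × n ≡ p ^ 7) ×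
    (Tdiv (Tstar n) ≡ n ^ 5 → ∃[ p ] Prime p × n ≡ p ^ 9) ×
    (Tdiv (Tstar n) ≡ n ^ 6 → ∃[ p ] Prime p × n ≡ p ^ 11) ×
    (Tdiv (Tstar n) ≡ n ^ 7 → ∃[ p ] Prime p × n ≡ p ^ 13) ×
    (Tdiv (Tstar n) ≡ n ^ 8 → ∃[ p ] Prime p × n ≡ p ^ 15) ×
    (Tdiv (Tstar n) ≡ n ^ 9 →
      (∃[ p ] Prime p × n ≡ p ^ 17) ⊎
      (∃[ p ] ∃[ q ] Prime p × Prime q × p ≢ q × n ≡ p * q)) ×
    (Tdiv (Tstar n) ≡ n ^ 10 → ∃[ p ] Prime p × n ≡ p ^ 19)
theorem3p1 n 1<n =
  prime-power 2 (λ ()) , prime-power 3 (λ ()) , prime-power 4 (λ ()) , prime-power 5 (λ ()) ,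
  prime-power 6 (λ ()) , prime-power 7 (λ ()) , prime-power 8 (λ ()) ,
  (λ perfect → Sum.map₂ proj₂ (T[T*n]≡nᵏ-classification 1<n (toWitness {a? = 9 ≤? 10} _) perfect)) ,
  prime-power 10 (λ ())
  where
  prime-power : ∀ k {k≤10 : True (k ≤? 10)} → k ≢ 9 →
                Tdiv (Tstar n) ≡ n ^ k → ∃[ p ] Prime p × n ≡ p ^ (k + k ∸ 1)
  prime-power k {k≤10} k≢9 perfect with T[T*n]≡nᵏ-classification 1<n (toWitness k≤10) perfect
  ... | inj₁ n≡pᵏ⁺ᵏ⁻¹  = n≡pᵏ⁺ᵏ⁻¹
  ... | inj₂ (k≡9 , _) = contradiction k≡9 k≢9
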